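{- Let $q\ge 2$, $n\geq 2$ and $r\geq 1$ be integers, let $S=(s_i)$ be an orientable sequence of order $n$ over $\mathbb{Z}_q$, and let $\mathbf{v}=(v_0,\ldots,v_{n-r-1})$ be a symmetric $q$-ary $(n-r)$-tuple. Then $|L_S(\mathbf{v})|$ is even.
   Context: A periodic sequence $S=(s_i)$ over $\mathbb{Z}_q$ with (least) period $m$ has $n$-tuples $\mathbf{s}_n(i)=(s_i,s_{i+1},\dots,s_{i+n-1})$. The reverse of $\mathbf{u}=(u_0,\dots,u_{n-1})$ is $\mathbf{u}^R=(u_{n-1},\dots,u_0)$; $\mathbf{u}$ is symmetric if $\mathbf{u}=\mathbf{u}^R$. $S$ is an $n$-window sequence if $\mathbf{s}_n(i)=\mathbf{s}_n(j)$ implies $i\equiv j\pmod m$. $S$ is an orientable sequence of order $n$ if it is an $n$-window sequence and $\mathbf{s}_n(i)\neq\mathbf{s}_n(j)^R$ for all $i,j$. $S^R$ denotes the sequence $S$ read in the reverse direction. For a $q$-ary $(n-r)$-tuple $\mathbf{v}$, $L_n(\mathbf{v})$ is the set of $n$-tuples over $\mathbb{Z}_q$ whose first $n-r$ entries equal $\mathbf{v}$, and $L_S(\mathbf{v})$ is the set of those $\mathbf{u}\in L_n(\mathbf{v})$ that appear (as $n$ consecutive entries) in $S$ or in $S^R$. -}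

module Defs where

open import Data.Nat using (ℕ; zero; suc; _+_; _∸_; _≤_; _<_; NonZero)
open import Data.Nat.DivMod using (_%_)
open import Data.Fin using (Fin; toℕ)
open import Data.Vec using (Vec; tabulate; reverse; take)
open import Data.List using (List; length)
open import Data.List.Relation.Unary.Unique.Propositional using (Unique)
open import Data.List.Membership.Propositional using (_∈_)
open import Data.Product using (Σ; ∃; _×_)
open import Data.Sum using (_⊎_)
open import Function.Bundles using (_⇔_)
open import Relation.Binary.PropositionalEquality using (_≡_; _≢_)

Seq : ℕ → Set
Seq q = ℕ → Fin q

window : ∀ {q} → Seq q → (n : ℕ) → ℕ → Vec (Fin q) n
window s n i = tabulate (λ k → s (i + toℕ k))

HasPeriod : ∀ {q} → Seq q → ℕ → Set
HasPeriod s p = ∀ i → s (i + p) ≡ s i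

LeastPeriod : ∀ {q} → Seq q → ℕ → Set
LeastPeriod s m = (0 < m) × HasPeriod s m × (∀ p → 0 < p → HasPeriod s p → m ≤ p)

Symmetric : ∀ {A : Set} {k} → Vec A k → Set
Symmetric u = u ≡ reverse u

IsWindow : ∀ {q} → Seq q → (m : ℕ) → .{{NonZero m}} → ℕ → Set
IsWindow s m n = ∀ i j → window s n i ≡ window s n j → i % m ≡ j % m

IsOrientable : ∀ {q} → Seq q → (m : ℕ) → .{{NonZero m}} → ℕ → Set
IsOrientable s m n = IsWindow s m n × (∀ i j → window s n i ≢ reverse (window s n j))

-- S^R : S read in reverse direction: (s_{m-1}, s_{m-2}, ..., s_0, s_{m-1}, ...)
revSeq : ∀ {q} → Seq q → (m : ℕ) → .{{NonZero m}} → Seq q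
revSeq s m i = s (m ∸ 1 ∸ i % m)

AppearsIn : ∀ {q n} → Seq q → Vec (Fin q) n → Set
AppearsIn {n = n} s u = ∃ λ i → window s n i ≡ u

-- L_S(v) for v of length p, with n = p + r: n-tuples with prefix v appearing in S or S^R
InLS : ∀ {q} → Seq q → (m : ℕ) → .{{NonZero m}} → (p r : ℕ) →
       Vec (Fin q) p → Vec (Fin q) (p + r) → Set
InLS s m p r v u = (take p u ≡ v) × (AppearsIn s u ⊎ AppearsIn (revSeq s m) u)

HasCard : {A : Set} → (A → Set) → ℕ → Set
HasCard {A} P k = Σ (List A) λ xs → Unique xs × (∀ a → (a ∈ xs) ⇔ P a) × (length xs ≡ k)

{-# OPTIONS --safe #-}
-- A tuple occurs in S^R exactly when its reverse occurs in S, and orientability forbids a tuple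
-- and its reverse from both occurring in S. Pair a tuple u occurring in S at position i with the
-- reverse of the window at position i − r: as v is symmetric, this partner again starts with v,
-- and the window property makes the pairing a fixed-point-free involution on L_S(v), so
-- |L_S(v)| is even.
module Submission where

open import Defs
open import Level using (_⊔_; 0ℓ)
open import Data.Nat using (ℕ; zero; suc; _+_; _*_; _∸_; _≤_; _<_; NonZero)
open import Data.Nat.Properties
open import Algebra.Properties.CommutativeSemigroup +-commutativeSemigroup using (xy∙z≈xz∙y)
open import Data.Nat.DivMod using (_%_; _/_; m≡m%n+[m/n]*n; m%n<n)
open import Data.Nat.Divisibility using (_∣_; _∣0; ∣-refl; ∣m∣n⇒∣m+n)
open import Data.Nat.Induction using (<-wellFounded)
open import Data.Nat.Tactic.RingSolver using (solve-∀)
open import Data.Fin using (Fin; toℕ; fromℕ; inject₁; opposite; _↑ˡ_)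
  renaming (zero to fzero; suc to fsuc)
open import Data.Fin.Properties using (opposite-prop; opposite-involutive; toℕ-↑ˡ; toℕ<n)
open import Data.Vec using (Vec; []; _∷_; _∷ʳ_; lookup; reverse; take; tabulate)
open import Data.Vec.Properties
  using (reverse-∷; reverse-involutive; reverse-injective; reverse-reverse;
         tabulate∘lookup; lookup∘tabulate; tabulate-cong)
open import Data.List using (List; []; _∷_; length)
open import Data.List.Membership.Propositional using (_∈_; _∉_)
open import Data.List.Membership.Propositional.Properties using (∈-∃++)
open import Data.List.Relation.Unary.Any using (here; there)
open import Data.List.Relation.Unary.Unique.Propositional using (Unique; _∷_)
open import Data.List.Relation.Unary.Unique.Propositional.Properties using (Unique[x∷xs]⇒x∉xs)
open import Data.List.Relation.Binary.Permutation.Propositional using (_↭_; ↭-sym; ↭⇒↭ₛ)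
open import Data.List.Relation.Binary.Permutation.Propositional.Properties
  using (∈-resp-↭; ↭-length; shift)
import Data.List.Relation.Binary.Permutation.Setoid.Properties as Permutationₛ
open import Data.Product using (∃-syntax; _×_; _,_; proj₁; proj₂)
open import Data.Sum as Sum using (_⊎_; inj₁; inj₂)
open import Data.Empty using (⊥-elim)
open import Function using (_∘_)
open import Function.Bundles using (_⇔_; mk⇔; Equivalence)
open import Induction.WellFounded using (Acc; acc)
open import Relation.Nullary using (¬_)
open import Relation.Binary.Core using (Rel)
import Relation.Binary.Definitions as Binary
open import Relation.Binary.Rewriting using (Deterministic)
open import Relation.Binary.PropositionalEquality
open ≡-Reasoning

module _ {a} {A : Set a} where

  lookup-∷ʳ-fromℕ : ∀ {n} x (xs : Vec A n) → lookup (xs ∷ʳ x) (fromℕ n) ≡ x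
  lookup-∷ʳ-fromℕ x []       = refl
  lookup-∷ʳ-fromℕ x (_ ∷ xs) = lookup-∷ʳ-fromℕ x xs

  lookup-∷ʳ-inject₁ : ∀ {n} x (xs : Vec A n) i → lookup (xs ∷ʳ x) (inject₁ i) ≡ lookup xs i
  lookup-∷ʳ-inject₁ x (_ ∷ xs) fzero    = refl
  lookup-∷ʳ-inject₁ x (_ ∷ xs) (fsuc i) = lookup-∷ʳ-inject₁ x xs i

  lookup-reverse-opposite : ∀ {n} (xs : Vec A n) i → lookup (reverse xs) (opposite i) ≡ lookup xs i
  lookup-reverse-opposite (x ∷ xs) fzero = begin
    lookup (reverse (x ∷ xs)) (fromℕ _)  ≡⟨ cong (λ ys → lookup ys _) (reverse-∷ x xs) ⟩
    lookup (reverse xs ∷ʳ x) (fromℕ _)   ≡⟨ lookup-∷ʳ-fromℕ x (reverse xs) ⟩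
    x                                    ∎
  lookup-reverse-opposite (x ∷ xs) (fsuc i) = begin
    lookup (reverse (x ∷ xs)) (inject₁ (opposite i))  ≡⟨ cong (λ ys → lookup ys _) (reverse-∷ x xs) ⟩
    lookup (reverse xs ∷ʳ x) (inject₁ (opposite i))   ≡⟨ lookup-∷ʳ-inject₁ x (reverse xs) (opposite i) ⟩
    lookup (reverse xs) (opposite i)                  ≡⟨ lookup-reverse-opposite xs i ⟩
    lookup xs i                                       ∎

  lookup-reverse : ∀ {n} (xs : Vec A n) i → lookup (reverse xs) i ≡ lookup xs (opposite i)
  lookup-reverse xs i = begin
    lookup (reverse xs) i                     ≡⟨ cong (lookup (reverse xs)) (opposite-involutive i) ⟨
    lookup (reverse xs) (opposite (opposite i)) ≡⟨ lookup-reverse-opposite xs (opposite i) ⟩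
    lookup xs (opposite i)                    ∎

  reverse-tabulate : ∀ {n} (f : Fin n → A) → reverse (tabulate f) ≡ tabulate (f ∘ opposite)
  reverse-tabulate f = begin
    reverse (tabulate f)                     ≡⟨ tabulate∘lookup _ ⟨
    tabulate (lookup (reverse (tabulate f))) ≡⟨ tabulate-cong (λ k → lookup-reverse (tabulate f) k) ⟩
    tabulate (lookup (tabulate f) ∘ opposite) ≡⟨ tabulate-cong (λ k → lookup∘tabulate f (opposite k)) ⟩
    tabulate (f ∘ opposite)                  ∎

  take-tabulate : ∀ m {n} (f : Fin (m + n) → A) → take m (tabulate f) ≡ tabulate (f ∘ (_↑ˡ n))
  take-tabulate zero    f = refl
  take-tabulate (suc m) f = cong (f fzero ∷_) (take-tabulate m (f ∘ fsuc))

PairedWithin : ∀ {a ℓ} {A : Set a} → Rel A ℓ → List A → Set (a ⊔ ℓ)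
PairedWithin R xs = ∀ {x} → x ∈ xs → ∃[ y ] R x y × y ∈ xs

module _ {a} {A : Set a} where

  open Permutationₛ (setoid A) using (Unique-resp-↭)

  ∈-∃↭ : ∀ {y : A} {xs} → y ∈ xs → ∃[ ws ] xs ↭ y ∷ ws
  ∈-∃↭ {y} y∈xs with ys , zs , refl ← ∈-∃++ y∈xs = _ , shift y ys zs

  module _ {ℓ} {R : Rel A ℓ} (R-sym : Binary.Symmetric R) (R-irrefl : ∀ {x} → ¬ R x x)
           (R-det : Deterministic _≡_ R) where

    drop-pair : ∀ {x xs} → Unique (x ∷ xs) → PairedWithin R (x ∷ xs) →
                ∃[ ws ] length xs ≡ suc (length ws) × Unique ws × PairedWithin R ws
    drop-pair {x} {xs} x∷xs-unique@(_ ∷ xs-unique) paired with paired (here refl)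
    ... | y , xRy , here refl = ⊥-elim (R-irrefl xRy)
    ... | y , xRy , there y∈xs
      with ws , xs↭y∷ws ← ∈-∃↭ y∈xs
      with y∷ws-unique@(_ ∷ ws-unique) ← Unique-resp-↭ (↭⇒↭ₛ xs↭y∷ws) xs-unique
      = ws , ↭-length xs↭y∷ws , ws-unique , paired-ws
      where
      ws⊆xs : ∀ {a} → a ∈ ws → a ∈ xs
      ws⊆xs = ∈-resp-↭ (↭-sym xs↭y∷ws) ∘ there

      x∉ws : x ∉ ws
      x∉ws = Unique[x∷xs]⇒x∉xs x∷xs-unique ∘ ws⊆xs

      y∉ws : y ∉ ws
      y∉ws = Unique[x∷xs]⇒x∉xs y∷ws-unique

      -- x and y are each other's only partners, so no element of ws is paired with them.
      paired-ws : PairedWithin R ws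
      paired-ws {a} a∈ws with paired (there (ws⊆xs a∈ws))
      ... | b , aRb , here refl = ⊥-elim (y∉ws (subst (_∈ ws) (R-det (R-sym aRb) xRy) a∈ws))
      ... | b , aRb , there b∈xs with ∈-resp-↭ xs↭y∷ws b∈xs
      ...   | here refl  = ⊥-elim (x∉ws (subst (_∈ ws) (R-det (R-sym aRb) (R-sym xRy)) a∈ws))
      ...   | there b∈ws = b , aRb , b∈ws

    unique∧paired⇒2∣length : ∀ {xs} → Unique xs → PairedWithin R xs → 2 ∣ length xs
    unique∧paired⇒2∣length = go (<-wellFounded _)
      where
      go : ∀ {xs} → Acc _<_ (length xs) → Unique xs → PairedWithin R xs → 2 ∣ length xs
      go {[]}     _         _      _      = 2 ∣0
      go {x ∷ xs} (acc rec) unique paired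
        with ws , len , ws-unique , ws-paired ← drop-pair unique paired =
        subst (λ l → 2 ∣ suc l) (sym len)
          (∣m∣n⇒∣m+n ∣-refl (go (rec (m<n⇒m<1+n (≤-reflexive (sym len)))) ws-unique ws-paired))

module _ {q} (s : Seq q) where

  take-window : ∀ p r i → take p (window s (p + r) i) ≡ window s p i
  take-window p r i =
    trans (take-tabulate p _) (tabulate-cong λ k → cong (λ t → s (i + t)) (toℕ-↑ˡ k r))

  reverse-window : ∀ n i → reverse (window s n i) ≡ tabulate (λ k → s (i + (n ∸ suc (toℕ k))))
  reverse-window n i =
    trans (reverse-tabulate _) (tabulate-cong λ k → cong (λ t → s (i + t)) (opposite-prop k))

  take-reverse-window : ∀ p r i → take p (reverse (window s (p + r) i)) ≡ reverse (window s p (i + r))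
  take-reverse-window p r i = begin
    take p (reverse (window s (p + r) i))                   ≡⟨ cong (take p) (reverse-window (p + r) i) ⟩
    take p (tabulate (λ k → s (i + (p + r ∸ suc (toℕ k))))) ≡⟨ take-tabulate p _ ⟩
    tabulate (λ k → s (i + (p + r ∸ suc (toℕ (k ↑ˡ r)))))   ≡⟨ tabulate-cong (cong s ∘ index) ⟩
    tabulate (λ k → s (i + r + (p ∸ suc (toℕ k))))          ≡⟨ reverse-window p (i + r) ⟨
    reverse (window s p (i + r))                            ∎
    where
    index : ∀ k → i + (p + r ∸ suc (toℕ (k ↑ˡ r))) ≡ i + r + (p ∸ suc (toℕ k))
    index k = begin
      i + (p + r ∸ suc (toℕ (k ↑ˡ r))) ≡⟨ cong (λ t → i + (p + r ∸ suc t)) (toℕ-↑ˡ k r) ⟩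
      i + (p + r ∸ suc (toℕ k))        ≡⟨ cong (i +_) (+-∸-comm r (toℕ<n k)) ⟩
      i + (p ∸ suc (toℕ k) + r)        ≡⟨ cong (i +_) (+-comm _ r) ⟩
      i + (r + (p ∸ suc (toℕ k)))      ≡⟨ +-assoc i r _ ⟨
      i + r + (p ∸ suc (toℕ k))        ∎

m+m*[n∸1]≡m*n : ∀ m n .{{_ : NonZero n}} → m + m * (n ∸ 1) ≡ m * n
m+m*[n∸1]≡m*n m n = trans (sym (*-suc m (n ∸ 1))) (cong (m *_) (suc-pred n))

module Periodic {q} {s : Seq q} {m} .{{_ : NonZero m}} (periodic : HasPeriod s m) where

  *-period : ∀ c → HasPeriod s (c * m)
  *-period zero    x = cong s (+-identityʳ x)
  *-period (suc c) x = begin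
    s (x + (m + c * m)) ≡⟨ cong (λ t → s (x + t)) (+-comm m (c * m)) ⟩
    s (x + (c * m + m)) ≡⟨ cong s (+-assoc x (c * m) m) ⟨
    s (x + c * m + m)   ≡⟨ periodic (x + c * m) ⟩
    s (x + c * m)       ≡⟨ *-period c x ⟩
    s x                 ∎

  window-*-period : ∀ n i c → window s n (i + c * m) ≡ window s n i
  window-*-period n i c = tabulate-cong λ k →
    trans (cong s (xy∙z≈xz∙y i (c * m) (toℕ k))) (*-period c (i + toℕ k))

  window-% : ∀ n i d → window s n (i + d) ≡ window s n (i % m + d)
  window-% n i d = begin
    window s n (i + d)                     ≡⟨ cong (λ t → window s n (t + d)) (m≡m%n+[m/n]*n i m) ⟩
    window s n (i % m + i / m * m + d)     ≡⟨ cong (window s n) (xy∙z≈xz∙y (i % m) (i / m * m) d) ⟩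
    window s n (i % m + d + i / m * m)     ≡⟨ window-*-period n (i % m + d) (i / m) ⟩
    window s n (i % m + d)                 ∎

  revSeq-reflect : ∀ x y c → suc x + y ≡ c * m → revSeq s m x ≡ s y
  revSeq-reflect x y c eq = begin
    s (m ∸ 1 ∸ a)               ≡⟨ *-period c _ ⟨
    s (m ∸ 1 ∸ a + c * m)       ≡⟨ cong (λ t → s (m ∸ 1 ∸ a + t)) eq ⟨
    s (m ∸ 1 ∸ a + (suc x + y)) ≡⟨ cong s (+-assoc _ (suc x) y) ⟨
    s (m ∸ 1 ∸ a + suc x + y)   ≡⟨ cong (λ t → s (t + y)) wrap ⟩
    s (suc b * m + y)           ≡⟨ cong s (+-comm _ y) ⟩
    s (y + suc b * m)           ≡⟨ *-period (suc b) y ⟩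
    s y                         ∎
    where
    a b : ℕ
    a = x % m
    b = x / m
    wrap : m ∸ 1 ∸ a + suc x ≡ suc b * m
    wrap = begin
      m ∸ 1 ∸ a + suc x             ≡⟨ cong (λ t → m ∸ 1 ∸ a + suc t) (m≡m%n+[m/n]*n x m) ⟩
      m ∸ 1 ∸ a + suc (a + b * m)   ≡⟨ +-suc _ _ ⟩
      suc (m ∸ 1 ∸ a + (a + b * m)) ≡⟨ cong suc (+-assoc (m ∸ 1 ∸ a) a (b * m)) ⟨
      suc (m ∸ 1 ∸ a + a + b * m)   ≡⟨ cong (λ t → suc (t + b * m)) (m∸n+n≡m (<⇒≤pred (m%n<n x m))) ⟩
      suc (m ∸ 1) + b * m           ≡⟨ cong (_+ b * m) (suc-pred m) ⟩
      suc b * m                     ∎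

  reverse-window-revSeq : ∀ n i j c → i + n + j ≡ c * m →
                          reverse (window (revSeq s m) n i) ≡ window s n j
  reverse-window-revSeq n i j c eq = trans (reverse-window (revSeq s m) n i) (tabulate-cong λ k →
    revSeq-reflect (i + (n ∸ suc (toℕ k))) (j + toℕ k) c (index k))
    where
    rearrange : ∀ i j d t → suc (i + d) + (j + t) ≡ i + (suc t + d) + j
    rearrange = solve-∀
    index : ∀ k → suc (i + (n ∸ suc (toℕ k))) + (j + toℕ k) ≡ c * m
    index k = begin
      suc (i + (n ∸ suc (toℕ k))) + (j + toℕ k) ≡⟨ rearrange i j _ (toℕ k) ⟩
      i + (suc (toℕ k) + (n ∸ suc (toℕ k))) + j ≡⟨ cong (λ t → i + t + j) (m+[n∸m]≡n (toℕ<n k)) ⟩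
      i + n + j                                 ≡⟨ eq ⟩
      c * m                                     ∎

  appearsIn-revSeq : ∀ {n} {u : Vec (Fin q) n} → AppearsIn (revSeq s m) u ⇔ AppearsIn s (reverse u)
  appearsIn-revSeq {n} {u} = mk⇔ to from
    where
    -- the witnesses use (x + n) * (m ∸ 1) ≡ −(x + n) (mod m)
    rearrange : ∀ y n j → y + n + j ≡ j + n + y
    rearrange = solve-∀
    to : AppearsIn (revSeq s m) u → AppearsIn s (reverse u)
    to (i , refl) =
      (i + n) * (m ∸ 1) , sym (reverse-window-revSeq n i _ (i + n) (m+m*[n∸1]≡m*n (i + n) m))
    from : AppearsIn s (reverse u) → AppearsIn (revSeq s m) u
    from (j , e) = (j + n) * (m ∸ 1) , reverse-injective (trans (reverse-window-revSeq n _ j (j + n)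
      (trans (rearrange _ n j) (m+m*[n∸1]≡m*n (j + n) m))) e)

  module _ {n} (window-injective : IsWindow s m n) where

    window-shift : ∀ {a b} d → window s n a ≡ window s n b → window s n (a + d) ≡ window s n (b + d)
    window-shift {a} {b} d eq = begin
      window s n (a + d)     ≡⟨ window-% n a d ⟩
      window s n (a % m + d) ≡⟨ cong (λ t → window s n (t + d)) (window-injective a b eq) ⟩
      window s n (b % m + d) ≡⟨ window-% n b d ⟨
      window s n (b + d)     ∎

    window-unshift : ∀ {a b} d → window s n (a + d) ≡ window s n (b + d) → window s n a ≡ window s n b
    window-unshift {a} {b} d eq = begin
      window s n a                     ≡⟨ window-*-period n a d ⟨
      window s n (a + d * m)           ≡⟨ cong (window s n) (full-turn a) ⟨
      window s n (a + d + d * (m ∸ 1)) ≡⟨ window-shift (d * (m ∸ 1)) eq ⟩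
      window s n (b + d + d * (m ∸ 1)) ≡⟨ cong (window s n) (full-turn b) ⟩
      window s n (b + d * m)           ≡⟨ window-*-period n b d ⟩
      window s n b                     ∎
      where
      full-turn : ∀ x → x + d + d * (m ∸ 1) ≡ x + d * m
      full-turn x = trans (+-assoc x d _) (cong (x +_) (m+m*[n∸1]≡m*n d m))

module Pairing {q} {s : Seq q} {m} .{{_ : NonZero m}} (periodic : HasPeriod s m)
               (p r : ℕ) (orientable : IsOrientable s m (p + r)) where

  open Periodic periodic using (window-*-period; window-shift; window-unshift)

  private
    n = p + r
    Tuple = Vec (Fin q) n

  Mirror : Rel Tuple 0ℓ
  Mirror u w = ∃[ i ] window s n (i + r) ≡ u × window s n i ≡ reverse w

  Paired : Rel Tuple 0ℓ
  Paired u w = Mirror u w ⊎ Mirror w u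

  ¬appears∧reverse-appears : ∀ {u : Tuple} → AppearsIn s u → ¬ AppearsIn s (reverse u)
  ¬appears∧reverse-appears (i , refl) (j , e) = proj₂ orientable j i e

  Mirror-take : ∀ {u w} → Mirror u w → take p w ≡ reverse (take p u)
  Mirror-take {u} {w} (i , e₁ , e₂) = begin
    take p w                              ≡⟨ cong (take p) (reverse-reverse (sym e₂)) ⟨
    take p (reverse (window s n i))       ≡⟨ take-reverse-window s p r i ⟩
    reverse (window s p (i + r))          ≡⟨ cong reverse (take-window s p r (i + r)) ⟨
    reverse (take p (window s n (i + r))) ≡⟨ cong (reverse ∘ take p) e₁ ⟩
    reverse (take p u)                    ∎

  Paired-sym : Binary.Symmetric Paired
  Paired-sym = Sum.swap

  Paired-irrefl : ∀ {u} → ¬ Paired u u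
  Paired-irrefl {u} = Sum.[ both , both ]
    where
    both : ¬ Mirror u u
    both (i , e₁ , e₂) = ¬appears∧reverse-appears (i + r , e₁) (i , e₂)

  Paired-deterministic : Deterministic _≡_ Paired
  Paired-deterministic (inj₁ (i , e₁ , e₂)) (inj₁ (j , f₁ , f₂)) =
    reverse-injective
      (trans (sym e₂) (trans (window-unshift (proj₁ orientable) r (trans e₁ (sym f₁))) f₂))
  Paired-deterministic (inj₂ (i , e₁ , e₂)) (inj₂ (j , f₁ , f₂)) =
    trans (sym e₁) (trans (window-shift (proj₁ orientable) r (trans e₂ (sym f₂))) f₁)
  Paired-deterministic (inj₁ (i , e₁ , _)) (inj₂ (j , _ , f₂)) =
    ⊥-elim (¬appears∧reverse-appears (i + r , e₁) (j , f₂))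
  Paired-deterministic (inj₂ (i , _ , e₂)) (inj₁ (j , f₁ , _)) =
    ⊥-elim (¬appears∧reverse-appears (j + r , f₁) (i , e₂))

  Paired-take : ∀ {u w} → Paired u w → take p w ≡ reverse (take p u)
  Paired-take (inj₁ u↦w) = Mirror-take u↦w
  Paired-take (inj₂ w↦u) = sym (reverse-reverse (sym (Mirror-take w↦u)))

  Paired-partner : ∀ {u : Tuple} → AppearsIn s u ⊎ AppearsIn s (reverse u) →
                   ∃[ w ] Paired u w × (AppearsIn s w ⊎ AppearsIn s (reverse w))
  Paired-partner (inj₁ (i , refl)) =
    reverse (window s n j) , inj₁ (j , back , reverse-involutive⁻¹) , inj₂ (j , reverse-involutive⁻¹)
    where
    -- j ≡ i − r (mod m)
    j = i + r * (m ∸ 1)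
    reverse-involutive⁻¹ : window s n j ≡ reverse (reverse (window s n j))
    reverse-involutive⁻¹ = sym (reverse-involutive _)
    back : window s n (j + r) ≡ window s n i
    back = begin
      window s n (i + r * (m ∸ 1) + r)  ≡⟨ cong (window s n) (+-assoc i _ r) ⟩
      window s n (i + (r * (m ∸ 1) + r)) ≡⟨ cong (λ t → window s n (i + t)) (+-comm _ r) ⟩
      window s n (i + (r + r * (m ∸ 1))) ≡⟨ cong (λ t → window s n (i + t)) (m+m*[n∸1]≡m*n r m) ⟩
      window s n (i + r * m)             ≡⟨ window-*-period n i r ⟩
      window s n i                       ∎
  Paired-partner (inj₂ (j , e)) = window s n (j + r) , inj₂ (j , refl , e) , inj₁ (j + r , refl)

lemma7 : (q p r m : ℕ) → .{{_ : NonZero m}} → 2 ≤ q → 2 ≤ p + r → 1 ≤ r →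
         (s : Seq q) → LeastPeriod s m → IsOrientable s m (p + r) →
         (v : Vec (Fin q) p) → Symmetric v →
         (k : ℕ) → HasCard (InLS s m p r v) k → 2 ∣ k
lemma7 q p r m _ _ _ s (_ , periodic , _) orientable v v-sym k (xs , xs-unique , xs-members , refl) =
  unique∧paired⇒2∣length Paired-sym Paired-irrefl Paired-deterministic xs-unique paired-within
  where
  open Periodic periodic using (appearsIn-revSeq)
  open Pairing periodic p r orientable
  open Equivalence using (to; from)

  paired-within : PairedWithin Paired xs
  paired-within {u} u∈xs
    with u-prefix , u-appears ← to (xs-members u) u∈xs
    with w , u~w , w-appears ← Paired-partner (Sum.map₂ (to appearsIn-revSeq) u-appears) =
    w , u~w , from (xs-members w) (w-prefix , Sum.map₂ (from appearsIn-revSeq) w-appears)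
    where
    w-prefix : take p w ≡ v
    w-prefix = trans (Paired-take u~w) (trans (cong reverse u-prefix) (sym v-sym))
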